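{- Let $n\geq 4$ be an even integer, let $\mathbb{D}_{2n}=\langle a,b \mid a^n=b^2=1,\ ba=a^{n-1}b\rangle$, let $\Psi=\{ab, a^{2}b, \dots , a^{n-1}b, b\}\cup\{a^{n/2}\}$, and let $\Lambda=\mathrm{Cay}(\mathbb{D}_{2n}, \Psi)$. Then the metric dimension of $\Lambda$ is $n$.
   Context: For a finite group $G$ and an inverse-closed subset $Q\subseteq G\setminus\{1\}$, the Cayley graph $\mathrm{Cay}(G,Q)$ has vertex set $G$ and edge set $\{\{x,y\} : x^{ -1}y\in Q\}$. For a connected graph $\Gamma$ with distance $d$, an ordered set $R=\{r_1,\dots,r_m\}$ of vertices is a resolving set if the vectors $(d(v,r_1),\dots,d(v,r_m))$ are pairwise distinct for distinct vertices $v$. The metric dimension of $\Gamma$ is the minimum cardinality of a resolving set. -}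

module Defs where

open import Data.Nat using (ℕ; zero; suc; _+_; _∸_; _<_; NonZero; _/_)
open import Data.Nat.DivMod using (_mod_)
open import Data.Fin using (Fin; toℕ)
open import Data.Unit using (⊤)
open import Data.Bool using (Bool; true; false; _xor_)
open import Data.Product using (_×_; _,_; Σ)
open import Data.List using (List)
open import Data.List.Membership.Propositional using (_∈_)
open import Relation.Binary.PropositionalEquality using (_≡_)
open import Relation.Nullary using (¬_)
open import Function.Bundles using (_⇔_)

-- The dihedral group D_{2n} of order 2n, realised concretely:
-- the pair (i , s) stands for a^i b^s  (i ∈ Z/n, s ∈ {0,1}, true = 1).
D : ℕ → Set
D n = Fin n × Bool

module Dihedral (n : ℕ) .{{_ : NonZero n}} where

  _+ₙ_ : Fin n → Fin n → Fin n
  i +ₙ k = (toℕ i + toℕ k) mod n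

  -ₙ_ : Fin n → Fin n
  -ₙ k = (n ∸ toℕ k) mod n

  -- (a^i b^s)(a^k b^t) = a^(i + (-1)^s k) b^(s+t),  using b a = a^(n-1) b
  _·_ : D n → D n → D n
  (i , false) · (k , t) = (i +ₙ k , t)
  (i , true)  · (k , t) = (i +ₙ (-ₙ k) , true xor t)

  -- the connection set Ψ = {ab, a^2 b, …, a^(n-1) b, b} ∪ {a^(n/2)}
  -- (membership predicate on elements)
  Ψ : D n → Set
  Ψ (i , true)  = ⊤
  Ψ (i , false) = toℕ i ≡ n / 2

  -- Walks in Cay(D_{2n}, Ψ): Walk k x y = there is a walk of length k from x to y;
  -- x and y are adjacent iff x⁻¹y ∈ Ψ, i.e. y = x · q for some q ∈ Ψ.
  data Walk : ℕ → D n → D n → Set where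
    here : ∀ {x} → Walk zero x x
    step : ∀ {k x} (q : D n) → Ψ q → ∀ {y} → Walk k (x · q) y → Walk (suc k) x y

  IsDist : D n → D n → ℕ → Set
  IsDist x y k = Walk k x y × (∀ j → j < k → ¬ Walk j x y)

  Resolving : List (D n) → Set
  Resolving R = ∀ v w → (∀ r → r ∈ R → ∀ k → (IsDist v r k ⇔ IsDist w r k)) → v ≡ w

module Submission where

-- Every reflection a^k b lies in Ψ, so two vertices on opposite cosets of ⟨a⟩
-- are adjacent; the only other generator is the central involution a^h, so a
-- vertex x has exactly one further neighbour, its partner p x = x a^h on the
-- same coset.  Hence Λ is K_{n,n} plus a perfect matching x ↔ p x, its diameter
-- is two, and d(x,y) ∈ {0,1,2} is decided by equality and adjacency.
--
-- Lower bound: partners x, p x are twins, i.e. equidistant from every third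
-- vertex, so a resolving set contains one of them for each of the n pairs;
-- mapping each element of R to the low-index member of its pair therefore
-- covers the n vertices a^i b^s with i < h, and a counting lemma for lists
-- gives n ≤ |R|.  Upper bound: those n low-index vertices R₀ resolve Λ: a
-- high-index v is the partner of a vertex of R₀, at distance 1 from it, and a
-- second vertex of R₀ on v's coset tells v apart from the opposite coset.

open import Defs
open import Data.Nat using (ℕ; zero; suc; _+_; _∸_; _≤_; _<_; NonZero; _/_; _%_; z≤n; s≤s; >-nonZero⁻¹)
open import Data.Nat.Properties
open import Data.Nat.DivMod
open import Data.Nat.Divisibility using (_∣_)
open import Data.Fin using (Fin; toℕ; fromℕ<; inject≤)
open import Data.Fin.Properties using (toℕ-injective; toℕ-fromℕ<; toℕ<n; toℕ-inject≤; inject≤-injective)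
import Data.Fin.Properties as Fin
open import Data.Bool using (true; false; not)
open import Data.Bool.Properties using (not-¬)
import Data.Bool.Properties as Bool
open import Data.Product using (_×_; _,_; Σ; proj₁; proj₂)
open import Data.Product.Properties using (≡-dec)
open import Data.Sum using (_⊎_; inj₁; inj₂)
open import Data.Empty using (⊥; ⊥-elim)
open import Data.Unit using (tt)
open import Function using (_∘_)
open import Function.Bundles using (mk⇔; Equivalence)
open import Relation.Nullary using (¬_; Dec; yes; no)
open import Relation.Nullary.Decidable using (decidable-stable)
open import Relation.Binary.PropositionalEquality
open import Relation.Binary.Definitions using (tri<; tri≈; tri>)
open import Data.List using (List; []; _∷_; map; _++_; length; allFin)
open import Data.List.Properties using (length-++; length-map; length-tabulate)
open import Data.List.Relation.Unary.Any using (here; there)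
import Data.List.Relation.Unary.All as All
open import Data.List.Relation.Unary.AllPairs using (_∷_)
open import Data.List.Relation.Unary.Unique.Propositional using (Unique)
import Data.List.Relation.Unary.Unique.Propositional.Properties as Unique
open import Data.List.Relation.Binary.Disjoint.Propositional using (Disjoint)
open import Data.List.Relation.Binary.Subset.Propositional using (_⊆_)
open import Data.List.Membership.Propositional using (_∈_; _∉_)
open import Data.List.Membership.Propositional.Properties using (∈-map⁻; ∈-map⁺; ∈-++⁻; ∈-++⁺ˡ; ∈-++⁺ʳ; ∈-allFin)
import Data.List.Membership.DecPropositional as DecMembership
open import Algebra.Properties.CommutativeSemigroup +-commutativeSemigroup using (x∙yz≈y∙xz)

∈∉⇒≢ : ∀ {A : Set} {xs : List A} {x y : A} → x ∈ xs → y ∉ xs → y ≢ x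
∈∉⇒≢ x∈xs y∉xs refl = y∉xs x∈xs

delete : ∀ {A : Set} {x : A} (ys : List A) → x ∈ ys → List A
delete (y ∷ ys) (here _)  = ys
delete (y ∷ ys) (there m) = y ∷ delete ys m

length-delete : ∀ {A : Set} {x : A} (ys : List A) (m : x ∈ ys) → suc (length (delete ys m)) ≡ length ys
length-delete (y ∷ ys) (here _)  = refl
length-delete (y ∷ ys) (there m) = cong suc (length-delete ys m)

∈-delete : ∀ {A : Set} {x z : A} (ys : List A) (m : x ∈ ys) → z ∈ ys → z ≢ x → z ∈ delete ys m
∈-delete (y ∷ ys) (here refl) (here refl) z≢x = ⊥-elim (z≢x refl)
∈-delete (y ∷ ys) (here _)    (there z∈)  _   = z∈
∈-delete (y ∷ ys) (there m)   (here z≡y)  _   = here z≡y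
∈-delete (y ∷ ys) (there m)   (there z∈)  z≢x = there (∈-delete ys m z∈ z≢x)

unique-⊆⇒length-≤ : ∀ {A : Set} (xs ys : List A) → Unique xs → xs ⊆ ys → length xs ≤ length ys
unique-⊆⇒length-≤ []       ys _              _  = z≤n
unique-⊆⇒length-≤ (x ∷ xs) ys (x∉xs ∷ uniq) xs⊆ys =
  subst (suc (length xs) ≤_) (length-delete ys x∈ys)
    (s≤s (unique-⊆⇒length-≤ xs (delete ys x∈ys) uniq
      (λ z∈xs → ∈-delete ys x∈ys (xs⊆ys (there z∈xs)) (λ z≡x → All.lookup x∉xs z∈xs (sym z≡x)))))
  where
  x∈ys = xs⊆ys (here refl)

module Modular (n : ℕ) .{{_ : NonZero n}} where
  open Dihedral n using (_+ₙ_; -ₙ_)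

  toℕ-mod : ∀ m → toℕ (m mod n) ≡ m % n
  toℕ-mod m = toℕ-fromℕ< _

  %-absorbʳ : ∀ a b → (a + b % n) % n ≡ (a + b) % n
  %-absorbʳ a b = begin
    (a + b % n) % n          ≡⟨ %-distribˡ-+ a (b % n) n ⟩
    (a % n + b % n % n) % n  ≡⟨ cong (λ c → (a % n + c) % n) (m%n%n≡m%n b n) ⟩
    (a % n + b % n) % n      ≡⟨ %-distribˡ-+ a b n ⟨
    (a + b) % n              ∎
    where open ≡-Reasoning

  %-absorbˡ : ∀ a b → (a % n + b) % n ≡ (a + b) % n
  %-absorbˡ a b = begin
    (a % n + b) % n  ≡⟨ cong (_% n) (+-comm (a % n) b) ⟩
    (b + a % n) % n  ≡⟨ %-absorbʳ b a ⟩
    (b + a) % n      ≡⟨ cong (_% n) (+-comm b a) ⟩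
    (a + b) % n      ∎
    where open ≡-Reasoning

  _-ₙ_ : Fin n → Fin n → Fin n
  j -ₙ i = (toℕ j + (n ∸ toℕ i)) mod n

  +ₙ-sub : ∀ i j → i +ₙ (j -ₙ i) ≡ j
  +ₙ-sub i j = toℕ-injective (begin
    toℕ (i +ₙ (j -ₙ i))          ≡⟨ toℕ-mod _ ⟩
    (a + toℕ (j -ₙ i)) % n       ≡⟨ cong (λ c → (a + c) % n) (toℕ-mod _) ⟩
    (a + (b + (n ∸ a)) % n) % n  ≡⟨ %-absorbʳ a _ ⟩
    (a + (b + (n ∸ a))) % n      ≡⟨ cong (_% n) (x∙yz≈y∙xz a b (n ∸ a)) ⟩
    (b + (a + (n ∸ a))) % n      ≡⟨ cong (λ c → (b + c) % n) (m+[n∸m]≡n (<⇒≤ (toℕ<n i))) ⟩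
    (b + n) % n                  ≡⟨ [m+n]%n≡m%n b n ⟩
    b % n                        ≡⟨ m<n⇒m%n≡m (toℕ<n j) ⟩
    b                            ∎)
    where
    open ≡-Reasoning
    a b : ℕ
    a = toℕ i
    b = toℕ j

  -ₙ-involutive : ∀ k → -ₙ (-ₙ k) ≡ k
  -ₙ-involutive k = toℕ-injective (begin
    toℕ (-ₙ (-ₙ k))              ≡⟨ toℕ-mod _ ⟩
    (n ∸ toℕ (-ₙ k)) % n         ≡⟨ cong (λ c → (n ∸ c) % n) (toℕ-mod _) ⟩
    (n ∸ (n ∸ toℕ k) % n) % n    ≡⟨ negneg (toℕ k) (toℕ<n k) ⟩
    toℕ k                        ∎)
    where
    open ≡-Reasoning
    negneg : ∀ K → K < n → (n ∸ (n ∸ K) % n) % n ≡ K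
    negneg zero    _   = begin
      (n ∸ n % n) % n  ≡⟨ cong (λ c → (n ∸ c) % n) (n%n≡0 n) ⟩
      n % n            ≡⟨ n%n≡0 n ⟩
      0                ∎
    negneg (suc K) K<n = begin
      (n ∸ (n ∸ suc K) % n) % n  ≡⟨ cong (λ c → (n ∸ c) % n) (m<n⇒m%n≡m (∸-monoʳ-< (s≤s z≤n) (<⇒≤ K<n))) ⟩
      (n ∸ (n ∸ suc K)) % n      ≡⟨ cong (_% n) (m∸[m∸n]≡n (<⇒≤ K<n)) ⟩
      suc K % n                  ≡⟨ m<n⇒m%n≡m K<n ⟩
      suc K                      ∎

module HalfTurn (n : ℕ) .{{_ : NonZero n}} (2∣n : 2 ∣ n) where
  open Dihedral n
  open Modular n

  h : ℕ
  h = n / 2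

  h+h≡n : h + h ≡ n
  h+h≡n = trans (cong (h +_) (sym (+-identityʳ h))) (m*[n/m]≡n 2∣n)

  h>0 : 0 < h
  h>0 = n≢0⇒n>0 λ h≡0 → <⇒≢ (>-nonZero⁻¹ n) (sym (trans (sym h+h≡n) (cong (λ m → m + m) h≡0)))

  h<n : h < n
  h<n = subst (h <_) h+h≡n (m<m+n h h>0)

  half : Fin n
  half = h mod n

  toℕ-half : toℕ half ≡ h
  toℕ-half = trans (toℕ-mod h) (m<n⇒m%n≡m h<n)

  -ₙhalf : -ₙ half ≡ half
  -ₙhalf = toℕ-injective (begin
    toℕ (-ₙ half)          ≡⟨ toℕ-mod _ ⟩
    (n ∸ toℕ half) % n     ≡⟨ cong (λ c → (n ∸ c) % n) toℕ-half ⟩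
    (n ∸ h) % n            ≡⟨ cong (λ m → (m ∸ h) % n) h+h≡n ⟨
    (h + h ∸ h) % n        ≡⟨ cong (_% n) (m+n∸n≡m h h) ⟩
    h % n                  ≡⟨ m<n⇒m%n≡m h<n ⟩
    h                      ≡⟨ toℕ-half ⟨
    toℕ half               ∎)
    where open ≡-Reasoning

  p : D n → D n
  p (i , s) = (i +ₙ half , s)

  toℕ-shift : ∀ i → toℕ (i +ₙ half) ≡ (toℕ i + h) % n
  toℕ-shift i = trans (toℕ-mod _) (cong (λ c → (toℕ i + c) % n) toℕ-half)

  shift-low : ∀ i → toℕ i < h → toℕ (i +ₙ half) ≡ toℕ i + h
  shift-low i i<h = trans (toℕ-shift i) (m<n⇒m%n≡m (subst (toℕ i + h <_) h+h≡n (+-monoˡ-< h i<h)))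

  shift-high : ∀ i → h ≤ toℕ i → toℕ (i +ₙ half) ≡ toℕ i ∸ h
  shift-high i h≤i = begin
    toℕ (i +ₙ half)       ≡⟨ toℕ-shift i ⟩
    (toℕ i + h) % n       ≡⟨ cong (λ m → (m + h) % n) (m∸n+n≡m h≤i) ⟨
    (toℕ i ∸ h + h + h) % n ≡⟨ cong (_% n) (trans (+-assoc (toℕ i ∸ h) h h) (cong (toℕ i ∸ h +_) h+h≡n)) ⟩
    (toℕ i ∸ h + n) % n   ≡⟨ [m+n]%n≡m%n (toℕ i ∸ h) n ⟩
    (toℕ i ∸ h) % n       ≡⟨ m<n⇒m%n≡m (≤-<-trans (m∸n≤m (toℕ i) h) (toℕ<n i)) ⟩
    toℕ i ∸ h             ∎
    where open ≡-Reasoning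

  high⇒shift-low : ∀ i → h ≤ toℕ i → toℕ (i +ₙ half) < h
  high⇒shift-low i h≤i = subst (_< h) (sym (shift-high i h≤i))
    (+-cancelʳ-< h (toℕ i ∸ h) h (subst (_< h + h) (sym (m∸n+n≡m h≤i)) (subst (toℕ i <_) (sym h+h≡n) (toℕ<n i))))

  p-involutive : ∀ x → p (p x) ≡ x
  p-involutive (i , s) = cong (_, s) (toℕ-injective (begin
    toℕ ((i +ₙ half) +ₙ half)  ≡⟨ toℕ-shift _ ⟩
    (toℕ (i +ₙ half) + h) % n  ≡⟨ cong (λ c → (c + h) % n) (toℕ-shift i) ⟩
    ((toℕ i + h) % n + h) % n  ≡⟨ %-absorbˡ (toℕ i + h) h ⟩
    (toℕ i + h + h) % n        ≡⟨ cong (_% n) (trans (+-assoc (toℕ i) h h) (cong (toℕ i +_) h+h≡n)) ⟩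
    (toℕ i + n) % n            ≡⟨ [m+n]%n≡m%n (toℕ i) n ⟩
    toℕ i % n                  ≡⟨ m<n⇒m%n≡m (toℕ<n i) ⟩
    toℕ i                      ∎))
    where open ≡-Reasoning

  p-injective : ∀ {x y} → p x ≡ p y → x ≡ y
  p-injective {x} {y} px≡py = trans (sym (p-involutive x)) (trans (cong p px≡py) (p-involutive y))

  p-no-fixed-point : ∀ x → p x ≢ x
  p-no-fixed-point (i , s) px≡x = by-cases (toℕ i <? h)
    where
    index-fixed : toℕ (i +ₙ half) ≡ toℕ i
    index-fixed = cong (toℕ ∘ proj₁) px≡x
    by-cases : Dec (toℕ i < h) → ⊥
    by-cases (yes i<h) = <⇒≢ (m<m+n (toℕ i) h>0) (sym (trans (sym (shift-low i i<h)) index-fixed))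
    by-cases (no i≮h)  = <⇒≢ (∸-monoʳ-< h>0 (≮⇒≥ i≮h)) (trans (sym (shift-high i (≮⇒≥ i≮h))) index-fixed)

  _≟D_ : (x y : D n) → Dec (x ≡ y)
  _≟D_ = ≡-dec Fin._≟_ Bool._≟_

  Adj : D n → D n → Set
  Adj x y = proj₂ x ≢ proj₂ y ⊎ y ≡ p x

  adj? : ∀ x y → Dec (Adj x y)
  adj? x y with proj₂ x Bool.≟ proj₂ y | y ≟D p x
  ... | no sx≢sy | _        = yes (inj₁ sx≢sy)
  ... | yes _    | yes y≡px = yes (inj₂ y≡px)
  ... | yes sx≡sy | no y≢px = no λ { (inj₁ sx≢sy) → sx≢sy sx≡sy ; (inj₂ y≡px) → y≢px y≡px }

  ·half : ∀ x → x · (half , false) ≡ p x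
  ·half (i , false) = refl
  ·half (i , true)  = cong (λ k → (i +ₙ k , true)) -ₙhalf

  Ψ-step⇒Adj : ∀ x q → Ψ q → Adj x (x · q)
  Ψ-step⇒Adj (i , false) (k , true)  _ = inj₁ λ ()
  Ψ-step⇒Adj (i , true)  (k , true)  _ = inj₁ λ ()
  Ψ-step⇒Adj x           (k , false) k≡h =
    inj₂ (trans (cong (λ k → x · (k , false)) (toℕ-injective (trans k≡h (sym toℕ-half)))) (·half x))

  Adj⇒Ψ-step : ∀ x y → Adj x y → Σ (D n) λ q → Ψ q × x · q ≡ y
  Adj⇒Ψ-step (i , false) (j , true)  _ = (j -ₙ i , true) , tt , cong (_, true) (+ₙ-sub i j)
  Adj⇒Ψ-step (i , true)  (j , false) _ =
    (-ₙ (j -ₙ i) , true) , tt , cong (_, false) (trans (cong (i +ₙ_) (-ₙ-involutive _)) (+ₙ-sub i j))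
  Adj⇒Ψ-step (i , false) (j , false) (inj₁ f≢f) = ⊥-elim (f≢f refl)
  Adj⇒Ψ-step (i , true)  (j , true)  (inj₁ t≢t) = ⊥-elim (t≢t refl)
  Adj⇒Ψ-step x           _           (inj₂ refl) = (half , false) , toℕ-half , ·half x

  prepend : ∀ {k x z y} → Adj x z → Walk k z y → Walk (suc k) x y
  prepend {x = x} {z} x~z walk with Adj⇒Ψ-step x z x~z
  ... | q , q∈Ψ , refl = step q q∈Ψ walk

  walk-0 : ∀ {x y} → Walk 0 x y → x ≡ y
  walk-0 here = refl

  walk-1 : ∀ {x y} → Walk 1 x y → Adj x y
  walk-1 {x} (step q q∈Ψ here) = Ψ-step⇒Adj x q q∈Ψ

  isDist-0 : ∀ x → IsDist x x 0
  isDist-0 x = here , λ _ ()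

  isDist-1 : ∀ {x y} → x ≢ y → Adj x y → IsDist x y 1
  isDist-1 x≢y x~y = prepend x~y here , λ { zero _ walk → x≢y (walk-0 walk) ; (suc j) (s≤s ()) }

  -- Non-adjacent vertices lie on one coset and share all neighbours on the other.
  isDist-2 : ∀ {x y} → x ≢ y → ¬ Adj x y → IsDist x y 2
  isDist-2 {x} {y} x≢y x≁y = prepend x~z (prepend z~y here) , shorter
    where
    z = (proj₁ x , not (proj₂ x))
    sx≡sy : proj₂ x ≡ proj₂ y
    sx≡sy = decidable-stable (proj₂ x Bool.≟ proj₂ y) (x≁y ∘ inj₁)
    x~z : Adj x z
    x~z = inj₁ (not-¬ refl)
    z~y : Adj z y
    z~y = inj₁ λ e → not-¬ (sym sx≡sy) (sym e)
    shorter : ∀ j → j < 2 → ¬ Walk j x y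
    shorter zero          _ walk = x≢y (walk-0 walk)
    shorter (suc zero)    _ walk = x≁y (walk-1 walk)
    shorter (suc (suc j)) (s≤s (s≤s ()))

  isDist-unique : ∀ {x y k k′} → IsDist x y k → IsDist x y k′ → k ≡ k′
  isDist-unique {k = k} {k′} (walk , minimal) (walk′ , minimal′) with <-cmp k k′
  ... | tri< k<k′ _ _ = ⊥-elim (minimal′ k k<k′ walk)
  ... | tri≈ _ k≡k′ _ = k≡k′
  ... | tri> _ _ k>k′ = ⊥-elim (minimal k′ k>k′ walk′)

  dist : D n → D n → ℕ
  dist x y with x ≟D y | adj? x y
  ... | yes _ | _     = 0
  ... | no _  | yes _ = 1
  ... | no _  | no _  = 2

  dist-isDist : ∀ x y → IsDist x y (dist x y)
  dist-isDist x y with x ≟D y | adj? x y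
  ... | yes refl | _       = isDist-0 x
  ... | no x≢y   | yes x~y = isDist-1 x≢y x~y
  ... | no x≢y   | no x≁y  = isDist-2 x≢y x≁y

  isDist⇒dist : ∀ {x y k} → IsDist x y k → dist x y ≡ k
  isDist⇒dist {x} {y} = isDist-unique (dist-isDist x y)

  dist≡0⇒≡ : ∀ {x y} → dist x y ≡ 0 → x ≡ y
  dist≡0⇒≡ {x} {y} d≡0 = walk-0 (proj₁ (subst (IsDist x y) d≡0 (dist-isDist x y)))

  dist≡1⇒Adj : ∀ {x y} → dist x y ≡ 1 → Adj x y
  dist≡1⇒Adj {x} {y} d≡1 = walk-1 (proj₁ (subst (IsDist x y) d≡1 (dist-isDist x y)))

  SameDistances : List (D n) → D n → D n → Set
  SameDistances R v w = ∀ r → r ∈ R → dist v r ≡ dist w r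

  resolving-separates : ∀ {R} → Resolving R → ∀ v w → SameDistances R v w → v ≡ w
  resolving-separates res v w same = res v w λ r r∈R k → mk⇔
    (λ d → subst (λ m → IsDist w r m) (trans (sym (same r r∈R)) (isDist⇒dist d)) (dist-isDist w r))
    (λ d → subst (λ m → IsDist v r m) (trans (same r r∈R) (isDist⇒dist d)) (dist-isDist v r))

  separates-resolving : ∀ {R} → (∀ v w → SameDistances R v w → v ≡ w) → Resolving R
  separates-resolving sep v w same = sep v w λ r r∈R →
    isDist⇒dist (Equivalence.from (same r r∈R (dist w r)) (dist-isDist w r))

  dist-cong : ∀ {x y r} → x ≢ r → y ≢ r → (Adj x r → Adj y r) → (Adj y r → Adj x r) → dist x r ≡ dist y r
  dist-cong {x} {y} {r} x≢r y≢r to from = by-cases (adj? x r)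
    where
    by-cases : Dec (Adj x r) → dist x r ≡ dist y r
    by-cases (yes x~r) = trans (isDist⇒dist (isDist-1 x≢r x~r)) (sym (isDist⇒dist (isDist-1 y≢r (to x~r))))
    by-cases (no x≁r)  = trans (isDist⇒dist (isDist-2 x≢r x≁r)) (sym (isDist⇒dist (isDist-2 y≢r (x≁r ∘ from))))

  partners-twins : ∀ x {r} → x ≢ r → p x ≢ r → dist x r ≡ dist (p x) r
  partners-twins (i , s) {r} x≢r px≢r = dist-cong x≢r px≢r to from
    where
    to : Adj (i , s) r → Adj (p (i , s)) r
    to (inj₁ s≢sr)  = inj₁ s≢sr
    to (inj₂ r≡px)  = ⊥-elim (px≢r (sym r≡px))
    from : Adj (p (i , s)) r → Adj (i , s) r
    from (inj₁ s≢sr) = inj₁ s≢sr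
    from (inj₂ r≡ppx) = ⊥-elim (x≢r (sym (trans r≡ppx (p-involutive (i , s)))))

  open DecMembership _≟D_ using (_∈?_)

  resolving-meets-pairs : ∀ {R} → Resolving R → ∀ x → x ∈ R ⊎ p x ∈ R
  resolving-meets-pairs {R} res x with x ∈? R | p x ∈? R
  ... | yes x∈R | _        = inj₁ x∈R
  ... | no _    | yes px∈R = inj₂ px∈R
  ... | no x∉R  | no px∉R  = ⊥-elim (p-no-fixed-point x (sym (resolving-separates res x (p x) twins)))
    where
    twins : SameDistances R x (p x)
    twins r r∈R = partners-twins x (∈∉⇒≢ r∈R x∉R) (∈∉⇒≢ r∈R px∉R)

  Low : D n → Set
  Low x = toℕ (proj₁ x) < h

  lows : List (Fin n)
  lows = map (λ i → inject≤ i (<⇒≤ h<n)) (allFin h)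

  ∈lows⁻ : ∀ {i} → i ∈ lows → toℕ i < h
  ∈lows⁻ i∈ with ∈-map⁻ (λ i → inject≤ i (<⇒≤ h<n)) i∈
  ... | j , _ , refl = subst (_< h) (sym (toℕ-inject≤ j (<⇒≤ h<n))) (toℕ<n j)

  ∈lows⁺ : ∀ {i} → toℕ i < h → i ∈ lows
  ∈lows⁺ i<h = subst (_∈ lows) (toℕ-injective (trans (toℕ-inject≤ _ (<⇒≤ h<n)) (toℕ-fromℕ< i<h)))
    (∈-map⁺ (λ i → inject≤ i (<⇒≤ h<n)) (∈-allFin (fromℕ< i<h)))

  R₀ : List (D n)
  R₀ = map (_, false) lows ++ map (_, true) lows

  ∈R₀⁻ : ∀ {x} → x ∈ R₀ → Low x
  ∈R₀⁻ x∈ with ∈-++⁻ (map (_, false) lows) x∈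
  ... | inj₁ x∈ˡ with ∈-map⁻ (_, false) x∈ˡ
  ...   | _ , i∈ , refl = ∈lows⁻ i∈
  ∈R₀⁻ x∈ | inj₂ x∈ʳ with ∈-map⁻ (_, true) x∈ʳ
  ...   | _ , i∈ , refl = ∈lows⁻ i∈

  ∈R₀⁺ : ∀ x → Low x → x ∈ R₀
  ∈R₀⁺ (i , false) i<h = ∈-++⁺ˡ (∈-map⁺ (_, false) (∈lows⁺ i<h))
  ∈R₀⁺ (i , true)  i<h = ∈-++⁺ʳ (map (_, false) lows) (∈-map⁺ (_, true) (∈lows⁺ i<h))

  R₀-unique : Unique R₀
  R₀-unique = Unique.++⁺ (Unique.map⁺ (cong proj₁) lows-unique) (Unique.map⁺ (cong proj₁) lows-unique) cosets-disjoint
    where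
    lows-unique : Unique lows
    lows-unique = Unique.map⁺ (inject≤-injective (<⇒≤ h<n) (<⇒≤ h<n) _ _) (Unique.allFin⁺ h)
    cosets-disjoint : Disjoint (map (_, false) lows) (map (_, true) lows)
    cosets-disjoint (x∈ˡ , x∈ʳ) with ∈-map⁻ (_, false) x∈ˡ | ∈-map⁻ (_, true) x∈ʳ
    ... | _ , _ , refl | _ , _ , ()

  length-R₀ : length R₀ ≡ n
  length-R₀ = begin
    length R₀                                                  ≡⟨ length-++ (map (_, false) lows) ⟩
    length (map (_, false) lows) + length (map (_, true) lows) ≡⟨ cong₂ _+_ (length-map _ lows) (length-map _ lows) ⟩
    length lows + length lows                                  ≡⟨ cong (λ m → m + m) length-lows ⟩
    h + h                                                      ≡⟨ h+h≡n ⟩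
    n                                                          ∎
    where
    open ≡-Reasoning
    length-lows : length lows ≡ h
    length-lows = trans (length-map _ (allFin h)) (length-tabulate _)

  lowPartner : D n → D n
  lowPartner x with toℕ (proj₁ x) <? h
  ... | yes _ = x
  ... | no _  = p x

  lowPartner-low : ∀ x → Low x → lowPartner x ≡ x
  lowPartner-low x x-low with toℕ (proj₁ x) <? h
  ... | yes _      = refl
  ... | no x-high  = ⊥-elim (x-high x-low)

  lowPartner-p : ∀ x → Low x → lowPartner (p x) ≡ x
  lowPartner-p (i , s) i<h with toℕ (i +ₙ half) <? h
  ... | yes shift<h = ⊥-elim (<⇒≱ shift<h (subst (h ≤_) (sym (shift-low i i<h)) (m≤n+m h (toℕ i))))
  ... | no _        = p-involutive (i , s)

  -- Lower bound: the low partners of R cover the n vertices of R₀.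
  lower-bound : ∀ R → Resolving R → n ≤ length R
  lower-bound R res = subst₂ _≤_ length-R₀ (length-map lowPartner R)
    (unique-⊆⇒length-≤ R₀ (map lowPartner R) R₀-unique covered)
    where
    covered : R₀ ⊆ map lowPartner R
    covered {x} x∈R₀ with resolving-meets-pairs res x
    ... | inj₁ x∈R  = subst (_∈ map lowPartner R) (lowPartner-low x (∈R₀⁻ x∈R₀)) (∈-map⁺ lowPartner x∈R)
    ... | inj₂ px∈R = subst (_∈ map lowPartner R) (lowPartner-p x (∈R₀⁻ x∈R₀)) (∈-map⁺ lowPartner px∈R)

  low≢high : ∀ {x y} → Low x → ¬ Low y → x ≢ y
  low≢high x-low y-high refl = y-high x-low

  module UpperBound (4≤n : 4 ≤ n) where

    2≤h : 2 ≤ h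
    2≤h = *-cancelˡ-≤ 2 (subst (4 ≤_) (sym (m*[n/m]≡n 2∣n)) 4≤n)

    lowIndex : ∀ m → m < h → Σ (Fin n) λ i → toℕ i ≡ m
    lowIndex m m<h = fromℕ< (<-trans m<h h<n) , toℕ-fromℕ< _

    anchor : ∀ s y → Σ (D n) λ r → Low r × proj₂ r ≡ s × r ≢ y
    anchor s y with lowIndex 0 (≤-trans (s≤s z≤n) 2≤h) | lowIndex 1 2≤h
    ... | i₀ , i₀≡0 | i₁ , i₁≡1 with (i₀ , s) ≟D y
    ...   | no r≢y  = (i₀ , s) , subst (_< h) (sym i₀≡0) (≤-trans (s≤s z≤n) 2≤h) , refl , r≢y
    ...   | yes r≡y = (i₁ , s) , subst (_< h) (sym i₁≡1) 2≤h , refl , 1≢0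
      where
      1≢0 : (i₁ , s) ≢ y
      1≢0 e = 0≢1+n (trans (sym i₀≡0) (trans (cong (toℕ ∘ proj₁) (trans r≡y (sym e))) i₁≡1))

    -- A high vertex v is at distance 1 from its low partner p v; a vertex w at
    -- that distance is v itself or lies on the other coset, where an anchor of
    -- v's coset sees it at distance 1 but v at distance 2.
    high-separated : ∀ v w → ¬ Low v → ¬ Low w → SameDistances R₀ v w → v ≡ w
    high-separated (i , s) w v-high w-high same with dist≡1⇒Adj (trans (sym (same (p v) pv∈R₀)) dist-v-pv)
      where
      v = (i , s)
      pv∈R₀ = ∈R₀⁺ (p v) (high⇒shift-low i (≮⇒≥ v-high))
      dist-v-pv = isDist⇒dist (isDist-1 (λ v≡pv → p-no-fixed-point v (sym v≡pv)) (inj₂ refl))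
    ... | inj₂ pv≡pw  = p-injective pv≡pw
    ... | inj₁ sw≢s   with anchor s (p (i , s))
    ...   | r , r-low , refl , r≢pv = ⊥-elim (1+n≢n (trans (sym dist-v-r) (trans (same r (∈R₀⁺ r r-low)) dist-w-r)))
      where
      dist-v-r : dist (i , s) r ≡ 2
      dist-v-r = isDist⇒dist (isDist-2 (low≢high r-low v-high ∘ sym)
        λ { (inj₁ s≢s) → s≢s refl ; (inj₂ r≡pv) → r≢pv r≡pv })
      dist-w-r : dist w r ≡ 1
      dist-w-r = isDist⇒dist (isDist-1 (low≢high r-low w-high ∘ sym) (inj₁ sw≢s))

    R₀-resolving : Resolving R₀
    R₀-resolving = separates-resolving separate
      where
      separate : ∀ v w → SameDistances R₀ v w → v ≡ w
      separate v w same with toℕ (proj₁ v) <? h | toℕ (proj₁ w) <? h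
      ... | yes v-low | _         = sym (dist≡0⇒≡ (trans (sym (same v (∈R₀⁺ v v-low))) (isDist⇒dist (isDist-0 v))))
      ... | no _      | yes w-low = dist≡0⇒≡ (trans (same w (∈R₀⁺ w w-low)) (isDist⇒dist (isDist-0 w)))
      ... | no v-high | no w-high = high-separated v w v-high w-high same

theorem3p3 : (n : ℕ) .{{_ : NonZero n}} → 4 ≤ n → 2 ∣ n →
    (Σ (List (D n)) (λ R → Unique R × length R ≡ n × Dihedral.Resolving n R))
    × (∀ (R : List (D n)) → Unique R → Dihedral.Resolving n R → n ≤ length R)
theorem3p3 n 4≤n 2∣n = (R₀ , R₀-unique , length-R₀ , R₀-resolving) , λ R _ → lower-bound R
  where
  open HalfTurn n 2∣n
  open UpperBound 4≤n
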